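{- Let $G$ be a finite abelian group and let $m_1, \dots, m_t$ be positive integers such that $G$ is isomorphic to $\bigoplus_{i=1}^t C_{m_i}$. Then \[ \sum_{i=1}^t \lfloor \log_2 m_i \rfloor + 1 \le \mathsf{D}_{\pm}(G) \le \Big\lfloor \sum_{i=1}^t \log_2 m_i \Big\rfloor + 1. \]
   Context: $C_m$ denotes a cyclic group of order $m$; the $m_i$ are not required to form a chain of divisors. For a finite abelian group $G$ (written additively), the plus-minus weighted Davenport constant $\mathsf{D}_{\pm}(G)$ is the smallest positive integer $\ell$ such that for every sequence $g_1,\dots,g_k$ of elements of $G$ (repetitions allowed) with $k \ge \ell$ there exist a non-empty subset $I \subset \{1,\dots,k\}$ and $a_i \in \{+1,-1\}$ ($i\in I$) with $\sum_{i \in I} a_i g_i = 0$. -}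

module Defs where

open import Level using (Level; 0ℓ)
open import Data.Nat as ℕ using (ℕ; zero; suc; _≤_; _+_; NonZero)
open import Data.Fin using (Fin; zero; suc)
open import Data.Fin.Subset using (Subset; _∈_; Nonempty)
open import Data.Integer as ℤ using (ℤ; +_)
open import Data.Integer.Divisibility using () renaming (_∣_ to _∣ℤ_)
open import Data.Product using (Σ; _×_)
open import Data.Nat.Logarithm using (⌊log₂_⌋)
open import Data.Bool using (true; false)
open import Data.Vec using ([]; _∷_)
open import Algebra.Bundles using (AbelianGroup; RawGroup)
open import Algebra.Morphism.Structures using (module GroupMorphisms)

sumℕ : ∀ {t} → (Fin t → ℕ) → ℕ
sumℕ {zero}  f = 0
sumℕ {suc t} f = f zero + sumℕ (λ i → f (suc i))

prodℕ : ∀ {t} → (Fin t → ℕ) → ℕ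
prodℕ {zero}  f = 1
prodℕ {suc t} f = f zero ℕ.* prodℕ (λ i → f (suc i))

DirectSumC : ∀ {t} → (Fin t → ℕ) → RawGroup 0ℓ 0ℓ
DirectSumC {t} m = record
  { Carrier = Fin t → ℤ
  ; _≈_     = λ f g → ∀ i → (+ m i) ∣ℤ (f i ℤ.- g i)
  ; _∙_     = λ f g i → f i ℤ.+ g i
  ; ε       = λ _ → + 0
  ; _⁻¹     = λ f i → ℤ.- f i
  }

IsoToDirectSum : ∀ {c ℓ} (G : AbelianGroup c ℓ) {t} → (Fin t → ℕ) → Set (c Level.⊔ ℓ)
IsoToDirectSum G m =
  Σ (AbelianGroup.Carrier G → (Fin _ → ℤ))
    (GroupMorphisms.IsGroupIsomorphism (AbelianGroup.rawGroup G) (DirectSumC m))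

data Sign : Set where
  plus minus : Sign

module _ {c ℓ} (G : AbelianGroup c ℓ) where
  open AbelianGroup G

  signed : Sign → Carrier → Carrier
  signed plus  g = g
  signed minus g = g ⁻¹

  signedSubsum : ∀ {k} → Subset k → (Fin k → Sign) → (Fin k → Carrier) → Carrier
  signedSubsum []           a g = ε
  signedSubsum (true ∷ I)  a g = signed (a zero) (g zero) ∙ signedSubsum I (λ i → a (suc i)) (λ i → g (suc i))
  signedSubsum (false ∷ I) a g = signedSubsum I (λ i → a (suc i)) (λ i → g (suc i))

  PMZeroSumProperty : ℕ → Set (c Level.⊔ ℓ)
  PMZeroSumProperty l =
    ∀ (k : ℕ) → l ≤ k → (g : Fin k → Carrier) →
      Σ (Subset k) λ I → Nonempty I × Σ (Fin k → Sign) λ a → signedSubsum I a g ≈ ε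

  IsDpm : ℕ → Set (c Level.⊔ ℓ)
  IsDpm l = 1 ≤ l × PMZeroSumProperty l × (∀ l' → 1 ≤ l' → PMZeroSumProperty l' → l ≤ l')

-- Upper bound: when |G| < 2^l, two of the 2^l plain subsums of a sequence of length l
-- coincide, and their difference is a ±-weighted subsum over the symmetric difference
-- of the two index sets. Lower bound: in ⊕ C_{m_i} the sequence of the 2^j e_i
-- (j < ⌊log₂ m_i⌋) has no ±-zero-subsum, since a non-empty ±-sum of distinct powers
-- 2^j with j < k is odd after removing the common power of two, hence non-zero, and
-- is smaller than 2^k ≤ m_i in absolute value. As G is finite the property is
-- decidable, and it is upward closed, so D±(G) exists as its least instance.
module Submission where

open import Defs
open import Level using (Level)
open import Data.Nat using (ℕ; _≤_; _+_; NonZero)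
open import Data.Fin using (Fin)
open import Data.Nat.Logarithm using (⌊log₂_⌋)
open import Data.Product using (Σ; _×_)
open import Algebra.Bundles using (AbelianGroup)

open import Level using (_⊔_; 0ℓ)
open import Data.Nat as ℕ using (_<_; _^_; s≤s; z≤n)
import Data.Nat.Properties as ℕ
import Data.Nat.Divisibility as ℕ∣
open import Data.Nat.Logarithm using (⌊log₂⌋-mono-≤; ⌊log₂[2^n]⌋≡n)
open import Data.Nat.Logarithm.Core using (⌊log2⌋)
open import Data.Fin using (_↑ˡ_; _↑ʳ_; toℕ; fromℕ<; remQuot; combine; finToFun; funToFin)
  renaming (zero to fz; suc to fs)
open import Data.Fin.Properties
  using (any?; all?; pigeonhole; <⇒≢; finToFun-funToFin; funToFin-finToFin; toℕ-fromℕ<; remQuot-combine)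
open import Data.Fin.Subset using (Subset; _∈_; Nonempty; Empty; ⊥)
open import Data.Fin.Subset.Properties using (anySubset?; nonempty?)
open import Data.Integer as ℤ using (ℤ; +_; ∣_∣)
import Data.Integer.Properties as ℤ
open import Data.Integer.Divisibility using (_∣_)
import Data.Integer.Divisibility.Signed as Signed
open import Data.Integer.DivMod using (_%ℕ_; _/ℕ_; n%ℕd<d; a≡a%ℕn+[a/ℕn]*n)
open import Data.Integer.Tactic.RingSolver using (solve-∀)
open import Data.Bool using (Bool; true; false; _xor_; if_then_else_)
open import Data.Vec using ([]; _∷_; _++_; zipWith; lookup; tabulate; splitAt; here; there)
open import Data.Vec.Properties using (lookup∘tabulate)
import Data.Vec.Functional as Vector
open import Data.Vec.Functional.Properties using (lookup-++ˡ; lookup-++ʳ)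
open import Data.Product using (∃; _,_; proj₁; proj₂)
open import Data.Empty using (⊥-elim)
open import Function using (_∘_; const)
open import Function.Bundles using (_⇔_; mk⇔; Equivalence)
import Function.Properties.Equivalence as ⇔
open import Function.Definitions using (Surjective)
open import Induction.WellFounded using (Acc; acc)
open import Algebra.Structures using (IsAbelianGroup)
open import Algebra.Morphism.Structures using (module GroupMorphisms)
open import Relation.Nullary using (¬_; Dec; yes; no; contradiction)
import Relation.Nullary.Decidable as Dec
open import Relation.Nullary.Decidable using (map′; _×-dec_)
open import Relation.Binary.Bundles using (Setoid)
open import Relation.Binary.Definitions using (Decidable)
open import Relation.Binary.PropositionalEquality as ≡ using (_≡_; _≢_; _≗_)
import Relation.Binary.Reasoning.Setoid as SetoidReasoning

Nonempty-∷ : ∀ {k b} {I : Subset k} → Nonempty I → Nonempty (b ∷ I)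
Nonempty-∷ (x , x∈I) = fs x , there x∈I

∈-++⁺ˡ : ∀ {k r} {I : Subset k} {J : Subset r} {x} → x ∈ I → (x ↑ˡ r) ∈ (I ++ J)
∈-++⁺ˡ here      = here
∈-++⁺ˡ (there p) = there (∈-++⁺ˡ p)

Empty-++ : ∀ {k r} {I : Subset k} {J : Subset r} → Empty I → Empty J → Empty (I ++ J)
Empty-++ {I = []}    _  ∅J x∈I++J          = ∅J x∈I++J
Empty-++ {I = _ ∷ _} ∅I _  (fz , here)      = ∅I (fz , here)
Empty-++ {I = _ ∷ _} ∅I ∅J (fs x , there p) = Empty-++ (∅I ∘ Nonempty-∷) ∅J (x , p)

module _ {n m p} {P : (Fin n → Fin m) → Set p}
         (P-resp : ∀ {f g} → f ≗ g → P f → P g) (P? : ∀ f → Dec (P f)) where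

  any-function? : Dec (∃ P)
  any-function? = map′ (λ (k , Pk) → finToFun k , Pk)
                       (λ (f , Pf) → funToFin f , P-resp (≡.sym ∘ finToFun-funToFin f) Pf)
                       (any? (P? ∘ finToFun))

  all-function? : Dec (∀ f → P f)
  all-function? = map′ (λ P∘finToFun f → P-resp (finToFun-funToFin f) (P∘finToFun (funToFin f)))
                       (λ Pf k → Pf (finToFun k))
                       (all? (P? ∘ finToFun))

funToFin-cong : ∀ {n m} {f g : Fin n → Fin m} → f ≗ g → funToFin f ≡ funToFin g
funToFin-cong {ℕ.zero}  f≗g = ≡.refl
funToFin-cong {ℕ.suc n} f≗g = ≡.cong₂ combine (f≗g fz) (funToFin-cong (f≗g ∘ fs))

finToFun-injective : ∀ {n m} {i j : Fin (m ^ n)} → finToFun {m} {n} i ≗ finToFun j → i ≡ j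
finToFun-injective {n} {m} {i} {j} i≗j = begin
  i                              ≡⟨ funToFin-finToFin {n} {m} i ⟨
  funToFin (finToFun {m} {n} i)  ≡⟨ funToFin-cong i≗j ⟩
  funToFin (finToFun {m} {n} j)  ≡⟨ funToFin-finToFin {n} {m} j ⟩
  j                              ∎
  where open ≡.≡-Reasoning

sign : Fin 2 → Sign
sign fz     = plus
sign (fs _) = minus

sign⁻¹ : Sign → Fin 2
sign⁻¹ plus  = fz
sign⁻¹ minus = fs fz

sign-sign⁻¹ : ∀ s → sign (sign⁻¹ s) ≡ s
sign-sign⁻¹ plus  = ≡.refl
sign-sign⁻¹ minus = ≡.refl

isOne : Fin 2 → Bool
isOne fz     = false
isOne (fs _) = true

isOne-injective : ∀ {x y} → isOne x ≡ isOne y → x ≡ y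
isOne-injective {fz}    {fz}    _  = ≡.refl
isOne-injective {fs fz} {fs fz} _  = ≡.refl
isOne-injective {fz}    {fs fz} ()
isOne-injective {fs fz} {fz}    ()

subsetOf : ∀ l → Fin (2 ^ l) → Subset l
subsetOf l k = tabulate (isOne ∘ finToFun {2} {l} k)

subsetOf-injective : ∀ l {i j} → subsetOf l i ≡ subsetOf l j → i ≡ j
subsetOf-injective l {i} {j} eq = finToFun-injective {l} {2} λ x → isOne-injective (begin
  isOne (finToFun {2} {l} i x)  ≡⟨ lookup∘tabulate (isOne ∘ finToFun {2} {l} i) x ⟨
  lookup (subsetOf l i) x       ≡⟨ ≡.cong (λ I → lookup I x) eq ⟩
  lookup (subsetOf l j) x       ≡⟨ lookup∘tabulate (isOne ∘ finToFun {2} {l} j) x ⟩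
  isOne (finToFun {2} {l} j x)  ∎)
  where open ≡.≡-Reasoning

record Enumeration {c ℓ} (S : Setoid c ℓ) (N : ℕ) : Set (c ⊔ ℓ) where
  open Setoid S
  field
    enum       : Fin N → Carrier
    index      : Carrier → Fin N
    enum-index : ∀ x → enum (index x) ≈ x

  index-injective : ∀ {x y} → index x ≡ index y → x ≈ y
  index-injective {x} {y} eq = trans (sym (enum-index x)) (trans (reflexive (≡.cong enum eq)) (enum-index y))

-- Signed subsums in an abelian group

module SignedSubsums {c ℓ} (G : AbelianGroup c ℓ) where
  open AbelianGroup G
  open import Algebra.Properties.AbelianGroup G using (identityˡ-unique; ε⁻¹≈ε)
  open import Algebra.Properties.CommutativeSemigroup commutativeSemigroup using (interchange; x∙yz≈y∙xz)
  open SetoidReasoning setoid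

  HasPMZeroSubsum : ∀ {k} → (Fin k → Carrier) → Set ℓ
  HasPMZeroSubsum {k} g =
    Σ (Subset k) λ I → Nonempty I × Σ (Fin k → Sign) λ a → signedSubsum G I a g ≈ ε

  signed-cong : ∀ s {x y} → x ≈ y → signed G s x ≈ signed G s y
  signed-cong plus  x≈y = x≈y
  signed-cong minus x≈y = ⁻¹-cong x≈y

  signedSubsum-cong : ∀ {k} (I : Subset k) {a a' g g'} → a ≗ a' → (∀ j → g j ≈ g' j) →
                      signedSubsum G I a g ≈ signedSubsum G I a' g'
  signedSubsum-cong []          a≗a' g≈g' = refl
  signedSubsum-cong (true ∷ I)  {a} a≗a' g≈g' =
    ∙-cong (trans (signed-cong (a fz) (g≈g' fz)) (reflexive (≡.cong (λ s → signed G s _) (a≗a' fz))))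
           (signedSubsum-cong I (a≗a' ∘ fs) (g≈g' ∘ fs))
  signedSubsum-cong (false ∷ I) a≗a' g≈g' = signedSubsum-cong I (a≗a' ∘ fs) (g≈g' ∘ fs)

  HasPMZeroSubsum-cong : ∀ {k} {g g' : Fin k → Carrier} → (∀ j → g j ≈ g' j) →
                         HasPMZeroSubsum g → HasPMZeroSubsum g'
  HasPMZeroSubsum-cong g≈g' (I , I≢∅ , a , S≈ε) =
    I , I≢∅ , a , trans (sym (signedSubsum-cong I (λ _ → ≡.refl) g≈g')) S≈ε

  signedSubsum-++ : ∀ {k r} (I : Subset k) (J : Subset r) a g →
    signedSubsum G (I ++ J) a g ≈
    signedSubsum G I (a ∘ (_↑ˡ r)) (g ∘ (_↑ˡ r)) ∙ signedSubsum G J (a ∘ (k ↑ʳ_)) (g ∘ (k ↑ʳ_))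
  signedSubsum-++ []          J a g = sym (identityˡ _)
  signedSubsum-++ (true ∷ I)  J a g =
    trans (∙-congˡ (signedSubsum-++ I J (a ∘ fs) (g ∘ fs))) (sym (assoc _ _ _))
  signedSubsum-++ (false ∷ I) J a g = signedSubsum-++ I J (a ∘ fs) (g ∘ fs)

  signedSubsum-⊥ : ∀ {k} a (g : Fin k → Carrier) → signedSubsum G ⊥ a g ≡ ε
  signedSubsum-⊥ {ℕ.zero}  a g = ≡.refl
  signedSubsum-⊥ {ℕ.suc k} a g = signedSubsum-⊥ (a ∘ fs) (g ∘ fs)

  signedSubsum-ε : ∀ {k} (I : Subset k) a {g} → (∀ j → g j ≈ ε) → signedSubsum G I a g ≈ ε
  signedSubsum-ε []          a g≈ε = refl
  signedSubsum-ε (true ∷ I)  a g≈ε = begin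
    signed G (a fz) _ ∙ _  ≈⟨ ∙-cong (signed-cong (a fz) (g≈ε fz))
                                      (signedSubsum-ε I (a ∘ fs) (g≈ε ∘ fs)) ⟩
    signed G (a fz) ε ∙ ε  ≈⟨ identityʳ _ ⟩
    signed G (a fz) ε      ≈⟨ signed-ε (a fz) ⟩
    ε                      ∎
    where
    signed-ε : ∀ s → signed G s ε ≈ ε
    signed-ε plus  = refl
    signed-ε minus = ε⁻¹≈ε
  signedSubsum-ε (false ∷ I) a g≈ε = signedSubsum-ε I (a ∘ fs) (g≈ε ∘ fs)

  HasPMZeroSubsum-extend : ∀ {k} r (g : Fin (k + r) → Carrier) →
                           HasPMZeroSubsum (g ∘ (_↑ˡ r)) → HasPMZeroSubsum g
  HasPMZeroSubsum-extend {k} r g (I , (x , x∈I) , a , I≈ε) =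
    I ++ ⊥ , (x ↑ˡ r , ∈-++⁺ˡ x∈I) , a' , (begin
      signedSubsum G (I ++ ⊥) a' g
        ≈⟨ signedSubsum-++ I ⊥ a' g ⟩
      signedSubsum G I (a' ∘ (_↑ˡ r)) (g ∘ (_↑ˡ r)) ∙ signedSubsum G ⊥ (a' ∘ (k ↑ʳ_)) (g ∘ (k ↑ʳ_))
        ≈⟨ ∙-cong (signedSubsum-cong I (lookup-++ˡ a (const plus)) (λ _ → refl))
                  (reflexive (signedSubsum-⊥ (a' ∘ (k ↑ʳ_)) (g ∘ (k ↑ʳ_)))) ⟩
      signedSubsum G I a (g ∘ (_↑ˡ r)) ∙ ε
        ≈⟨ identityʳ _ ⟩
      signedSubsum G I a (g ∘ (_↑ˡ r))
        ≈⟨ I≈ε ⟩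
      ε ∎)
    where
    a' : Fin (k + r) → Sign
    a' = a Vector.++ const plus

  AllHavePMZeroSubsum : ℕ → Set (c ⊔ ℓ)
  AllHavePMZeroSubsum l = (g : Fin l → Carrier) → HasPMZeroSubsum g

  PMZeroSumProperty⇔AllHavePMZeroSubsum : ∀ l → PMZeroSumProperty G l ⇔ AllHavePMZeroSubsum l
  PMZeroSumProperty⇔AllHavePMZeroSubsum l = mk⇔ (λ P → P l ℕ.≤-refl) from
    where
    from : AllHavePMZeroSubsum l → PMZeroSumProperty G l
    from all k l≤k g with ℕ.m≤n⇒∃[o]m+o≡n l≤k
    ... | r , ≡.refl = HasPMZeroSubsum-extend r g (all (g ∘ (_↑ˡ r)))

  PMZeroSumProperty-mono : ∀ {l l'} → l ≤ l' → PMZeroSumProperty G l → PMZeroSumProperty G l'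
  PMZeroSumProperty-mono l≤l' P k l'≤k = P k (ℕ.≤-trans l≤l' l'≤k)

  _Δ_ : ∀ {k} → Subset k → Subset k → Subset k
  _Δ_ = zipWith _xor_

  signsOf : ∀ {k} → Subset k → Fin k → Sign
  signsOf I j = if lookup I j then plus else minus

  subsum : ∀ {k} → Subset k → (Fin k → Carrier) → Carrier
  subsum I = signedSubsum G I (const plus)

  signedSubsum-Δ : ∀ {k} (I J : Subset k) g →
                   signedSubsum G (I Δ J) (signsOf I) g ∙ subsum J g ≈ subsum I g
  signedSubsum-Δ []          []          g = identityˡ ε
  signedSubsum-Δ (true ∷ I)  (true ∷ J)  g =
    trans (x∙yz≈y∙xz _ (g fz) _) (∙-congˡ (signedSubsum-Δ I J (g ∘ fs)))
  signedSubsum-Δ (true ∷ I)  (false ∷ J) g =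
    trans (assoc (g fz) _ _) (∙-congˡ (signedSubsum-Δ I J (g ∘ fs)))
  signedSubsum-Δ (false ∷ I) (true ∷ J)  g = begin
    (g fz ⁻¹ ∙ S) ∙ (g fz ∙ subsum J (g ∘ fs))  ≈⟨ interchange _ _ _ _ ⟩
    (g fz ⁻¹ ∙ g fz) ∙ (S ∙ subsum J (g ∘ fs))  ≈⟨ ∙-cong (inverseˡ (g fz))
                                                          (signedSubsum-Δ I J (g ∘ fs)) ⟩
    ε ∙ subsum I (g ∘ fs)                       ≈⟨ identityˡ _ ⟩
    subsum I (g ∘ fs)                           ∎
    where
    S : Carrier
    S = signedSubsum G (I Δ J) (signsOf I) (g ∘ fs)
  signedSubsum-Δ (false ∷ I) (false ∷ J) g = signedSubsum-Δ I J (g ∘ fs)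

  Δ-nonempty : ∀ {k} (I J : Subset k) → ¬ I ≡ J → Nonempty (I Δ J)
  Δ-nonempty []          []          I≢J = contradiction ≡.refl I≢J
  Δ-nonempty (true ∷ I)  (false ∷ J) I≢J = fz , here
  Δ-nonempty (false ∷ I) (true ∷ J)  I≢J = fz , here
  Δ-nonempty (true ∷ I)  (true ∷ J)  I≢J = Nonempty-∷ (Δ-nonempty I J (I≢J ∘ ≡.cong (true ∷_)))
  Δ-nonempty (false ∷ I) (false ∷ J) I≢J = Nonempty-∷ (Δ-nonempty I J (I≢J ∘ ≡.cong (false ∷_)))

  equalSubsums⇒HasPMZeroSubsum : ∀ {k} {I J : Subset k} g → ¬ I ≡ J → subsum I g ≈ subsum J g →
                                 HasPMZeroSubsum g
  equalSubsums⇒HasPMZeroSubsum {I = I} {J} g I≢J I≈J =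
    I Δ J , Δ-nonempty I J I≢J , signsOf I ,
    identityˡ-unique _ (subsum J g) (trans (signedSubsum-Δ I J g) I≈J)

module _ {c₁ ℓ₁ c₂ ℓ₂} (G : AbelianGroup c₁ ℓ₁) (H : AbelianGroup c₂ ℓ₂) where
  private
    module G = AbelianGroup G
    module H = AbelianGroup H
  open GroupMorphisms G.rawGroup H.rawGroup
  open SignedSubsums using (HasPMZeroSubsum; HasPMZeroSubsum-cong)

  module _ {f : G.Carrier → H.Carrier} (f-homo : IsGroupHomomorphism f) where
    open IsGroupHomomorphism f-homo

    signedSubsum-homo : ∀ {k} (I : Subset k) a g →
                        f (signedSubsum G I a g) H.≈ signedSubsum H I a (f ∘ g)
    signedSubsum-homo []          a g = ε-homo
    signedSubsum-homo (true ∷ I)  a g =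
      H.trans (homo _ _) (H.∙-cong (signed-homo (a fz) (g fz)) (signedSubsum-homo I (a ∘ fs) (g ∘ fs)))
      where
      signed-homo : ∀ s x → f (signed G s x) H.≈ signed H s (f x)
      signed-homo plus  x = H.refl
      signed-homo minus x = ⁻¹-homo x
    signedSubsum-homo (false ∷ I) a g = signedSubsum-homo I (a ∘ fs) (g ∘ fs)

    HasPMZeroSubsum-homo : ∀ {k} {g : Fin k → G.Carrier} →
                           HasPMZeroSubsum G g → HasPMZeroSubsum H (f ∘ g)
    HasPMZeroSubsum-homo {g = g} (I , I≢∅ , a , S≈ε) =
      I , I≢∅ , a , H.trans (H.sym (signedSubsum-homo I a g)) (H.trans (⟦⟧-cong S≈ε) ε-homo)

    PMZeroSumProperty-image : Surjective G._≈_ H._≈_ f →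
                              ∀ {l} → PMZeroSumProperty G l → PMZeroSumProperty H l
    PMZeroSumProperty-image surj P k l≤k h =
      HasPMZeroSubsum-cong H (λ j → proj₂ (surj (h j)) G.refl)
                             (HasPMZeroSubsum-homo (P k l≤k (proj₁ ∘ surj ∘ h)))

  module _ {f : G.Carrier → H.Carrier} (f-iso : IsGroupIsomorphism f) where
    open IsGroupIsomorphism f-iso

    Enumeration-iso : ∀ {N} → Enumeration H.setoid N → Enumeration G.setoid N
    Enumeration-iso E = record
      { enum       = proj₁ ∘ surjective ∘ E.enum
      ; index      = E.index ∘ f
      ; enum-index = λ x → injective (H.trans (proj₂ (surjective _) G.refl) (E.enum-index (f x)))
      }
      where module E = Enumeration E

    ≈-dec-iso : Decidable H._≈_ → Decidable G._≈_
    ≈-dec-iso _≟_ x y = map′ injective ⟦⟧-cong (f x ≟ f y)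

-- Finite abelian groups

least-upwardClosed : ∀ {p} {P : ℕ → Set p} → (∀ n → Dec (P n)) → (∀ {m n} → m ≤ n → P m → P n) →
                     ∀ {n} → P n → Σ ℕ λ d → P d × (∀ l → P l → d ≤ l)
least-upwardClosed P? up {ℕ.zero}  P0 = 0 , P0 , λ _ _ → z≤n
least-upwardClosed P? up {ℕ.suc n} P1+n with P? n
... | yes Pn = least-upwardClosed P? up Pn
... | no ¬Pn = ℕ.suc n , P1+n , λ l Pl → ℕ.≰⇒> (λ l≤n → ¬Pn (up l≤n Pl))

module _ {c ℓ} (G : AbelianGroup c ℓ) where
  open AbelianGroup G
  open SignedSubsums G

  HasPMZeroSubsum? : Decidable _≈_ → ∀ {k} (g : Fin k → Carrier) → Dec (HasPMZeroSubsum g)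
  HasPMZeroSubsum? _≟_ {k} g = anySubset? λ I → nonempty? I ×-dec signs? I
    where
    signs? : ∀ I → Dec (∃ λ a → signedSubsum G I a g ≈ ε)
    signs? I = map′ (λ (b , S≈ε) → sign ∘ b , S≈ε)
                    (λ (a , S≈ε) → sign⁻¹ ∘ a , resp (≡.sym ∘ sign-sign⁻¹ ∘ a) S≈ε)
                    (any-function? (λ b≗b' → resp (≡.cong sign ∘ b≗b'))
                                   (λ b → signedSubsum G I (sign ∘ b) g ≟ ε))
      where
      resp : ∀ {a a' : Fin k → Sign} → a ≗ a' → signedSubsum G I a g ≈ ε → signedSubsum G I a' g ≈ ε
      resp a≗a' = trans (sym (signedSubsum-cong I a≗a' (λ _ → refl)))

  module _ {N} (E : Enumeration setoid N) where
    open Enumeration E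

    AllHavePMZeroSubsum⇔enum : ∀ l → AllHavePMZeroSubsum l ⇔ (∀ c → HasPMZeroSubsum (enum ∘ c))
    AllHavePMZeroSubsum⇔enum l =
      mk⇔ (λ P c → P (enum ∘ c))
          (λ P∘enum g → HasPMZeroSubsum-cong (enum-index ∘ g) (P∘enum (index ∘ g)))

    PMZeroSumProperty? : Decidable _≈_ → ∀ l → Dec (PMZeroSumProperty G l)
    PMZeroSumProperty? _≟_ l =
      Dec.map (⇔.sym (⇔.trans (PMZeroSumProperty⇔AllHavePMZeroSubsum l) (AllHavePMZeroSubsum⇔enum l)))
        (all-function? (λ c≗c' → HasPMZeroSubsum-cong (reflexive ∘ ≡.cong enum ∘ c≗c'))
                       (HasPMZeroSubsum? _≟_ ∘ (enum ∘_)))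

    PMZeroSumProperty-pigeonhole : ∀ {l} → N < 2 ^ l → PMZeroSumProperty G l
    PMZeroSumProperty-pigeonhole {l} N<2^l =
      Equivalence.from (PMZeroSumProperty⇔AllHavePMZeroSubsum l) λ g →
        let i , j , i<j , eq = pigeonhole N<2^l (λ k → index (subsum (subsetOf l k) g))
        in equalSubsums⇒HasPMZeroSubsum g (<⇒≢ i<j ∘ subsetOf-injective l) (index-injective eq)

    IsDpm-between : Decidable _≈_ → ∀ {s U} → ¬ PMZeroSumProperty G s → PMZeroSumProperty G U →
                    Σ ℕ λ D → IsDpm G D × (s + 1 ≤ D) × (D ≤ U)
    IsDpm-between _≟_ {s} {U} ¬Ps PU =
      conclude (least-upwardClosed (PMZeroSumProperty? _≟_) PMZeroSumProperty-mono PU)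
      where
      conclude : (Σ ℕ λ d → PMZeroSumProperty G d × (∀ l → PMZeroSumProperty G l → d ≤ l)) →
                 Σ ℕ λ D → IsDpm G D × (s + 1 ≤ D) × (D ≤ U)
      conclude (D , PD , minimal) =
        D , (ℕ.≤-trans (s≤s z≤n) s<D , PD , λ l _ → minimal l) ,
        ≡.subst (_≤ D) (ℕ.+-comm 1 s) s<D , minimal U PU
        where
        s<D : s < D
        s<D = ℕ.≰⇒> λ D≤s → ¬Ps (PMZeroSumProperty-mono D≤s PD)

-- The groups ℤ/n and ⊕ C_{m_i}

infix 4 _≡_[mod_]

_≡_[mod_] : ℤ → ℤ → ℕ → Set
x ≡ y [mod n ] = + n ∣ (x ℤ.- y)

module _ (n : ℕ) where

  private
    toSigned : ∀ {u} → + n ∣ u → + n Signed.∣ u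
    toSigned {u} = Signed.∣ᵤ⇒∣ {+ n} {u}

    toUnsigned : ∀ {u} → + n Signed.∣ u → + n ∣ u
    toUnsigned {u} = Signed.∣⇒∣ᵤ {+ n} {u}

    ∣-+ : ∀ u v {w} → u ℤ.+ v ≡ w → + n ∣ u → + n ∣ v → + n ∣ w
    ∣-+ u v ≡.refl p q = toUnsigned {u ℤ.+ v} (Signed.∣m∣n⇒∣m+n (toSigned {u} p) (toSigned {v} q))

    ∣-neg : ∀ {u w} → ℤ.- u ≡ w → + n ∣ u → + n ∣ w
    ∣-neg {u} ≡.refl p = toUnsigned {ℤ.- u} (Signed.∣m⇒∣-m (toSigned {u} p))

  ≡⇒≡[mod] : ∀ {x y} → x ≡ y → x ≡ y [mod n ]
  ≡⇒≡[mod] {x} ≡.refl = ≡.subst (+ n ∣_) (≡.sym (ℤ.+-inverseʳ x)) (n ℕ∣.∣0)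

  mod-isAbelianGroup : IsAbelianGroup (λ x y → x ≡ y [mod n ]) ℤ._+_ (+ 0) (ℤ.-_)
  mod-isAbelianGroup = record
    { isGroup = record
      { isMonoid = record
        { isSemigroup = record
          { isMagma = record
            { isEquivalence = record
              { refl  = λ {x} → ≡⇒≡[mod] {x} ≡.refl
              ; sym   = λ {x y} → ∣-neg (sym-eq x y)
              ; trans = λ {x y z} → ∣-+ (x ℤ.- y) (y ℤ.- z) (trans-eq x y z)
              }
            ; ∙-cong = λ {x y u v} → ∣-+ (x ℤ.- y) (u ℤ.- v) (+-cong-eq x y u v)
            }
          ; assoc = λ x y z → ≡⇒≡[mod] (ℤ.+-assoc x y z)
          }
        ; identity = (λ x → ≡⇒≡[mod] (ℤ.+-identityˡ x)) , (λ x → ≡⇒≡[mod] (ℤ.+-identityʳ x))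
        }
      ; inverse = (λ x → ≡⇒≡[mod] (ℤ.+-inverseˡ x)) , (λ x → ≡⇒≡[mod] (ℤ.+-inverseʳ x))
      ; ⁻¹-cong = λ {x y} → ∣-neg (neg-cong-eq x y)
      }
    ; comm = λ x y → ≡⇒≡[mod] (ℤ.+-comm x y)
    }
    where
    sym-eq : ∀ x y → ℤ.- (x ℤ.- y) ≡ y ℤ.- x
    sym-eq = solve-∀
    trans-eq : ∀ x y z → (x ℤ.- y) ℤ.+ (y ℤ.- z) ≡ x ℤ.- z
    trans-eq = solve-∀
    +-cong-eq : ∀ x y u v → (x ℤ.- y) ℤ.+ (u ℤ.- v) ≡ (x ℤ.+ u) ℤ.- (y ℤ.+ v)
    +-cong-eq = solve-∀
    neg-cong-eq : ∀ x y → ℤ.- (x ℤ.- y) ≡ ℤ.- x ℤ.- ℤ.- y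
    neg-cong-eq = solve-∀

-- Its raw group is definitionally `DirectSumC m`, so an `IsoToDirectSum G m` is an
-- isomorphism onto this bundle.
⊕C-abelianGroup : ∀ {t} → (Fin t → ℕ) → AbelianGroup 0ℓ 0ℓ
⊕C-abelianGroup {t} m = record
  { Carrier        = Fin t → ℤ
  ; _≈_            = λ x y → ∀ i → x i ≡ y i [mod m i ]
  ; _∙_            = λ x y i → x i ℤ.+ y i
  ; ε              = λ _ → + 0
  ; _⁻¹            = λ x i → ℤ.- x i
  ; isAbelianGroup = record
    { isGroup = record
      { isMonoid = record
        { isSemigroup = record
          { isMagma = record
            { isEquivalence = record
              { refl  = λ {x} i → ℤ/.refl i {x i}
              ; sym   = λ {x y} p i → ℤ/.sym i {x i} {y i} (p i)
              ; trans = λ {x y z} p q i → ℤ/.trans i {x i} {y i} {z i} (p i) (q i)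
              }
            ; ∙-cong = λ {x y u v} p q i → ℤ/.∙-cong i {x i} {y i} {u i} {v i} (p i) (q i)
            }
          ; assoc = λ x y z i → ℤ/.assoc i (x i) (y i) (z i)
          }
        ; identity = (λ x i → ℤ/.identityˡ i (x i)) , (λ x i → ℤ/.identityʳ i (x i))
        }
      ; inverse = (λ x i → ℤ/.inverseˡ i (x i)) , (λ x i → ℤ/.inverseʳ i (x i))
      ; ⁻¹-cong = λ {x y} p i → ℤ/.⁻¹-cong i {x i} {y i} (p i)
      }
    ; comm = λ x y i → ℤ/.comm i (x i) (y i)
    }
  }
  where
  module ℤ/ i = IsAbelianGroup (mod-isAbelianGroup (m i))

⊕C-≈-dec : ∀ {t} (m : Fin t → ℕ) → Decidable (AbelianGroup._≈_ (⊕C-abelianGroup m))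
⊕C-≈-dec m x y = all? λ i → m i ℕ∣.∣? ∣ x i ℤ.- y i ∣

residue : ∀ n .{{_ : NonZero n}} → ℤ → Fin n
residue n x = fromℕ< (n%ℕd<d x n)

residue-≡[mod] : ∀ n .{{_ : NonZero n}} x → + toℕ (residue n x) ≡ x [mod n ]
residue-≡[mod] n x = Signed.∣⇒∣ᵤ {+ n} {+ toℕ (residue n x) ℤ.- x} (Signed.divides (ℤ.- q) (begin
  + toℕ (residue n x) ℤ.- x    ≡⟨ ≡.cong₂ (λ r y → + r ℤ.- y) (toℕ-fromℕ< (n%ℕd<d x n))
                                                               (a≡a%ℕn+[a/ℕn]*n x n) ⟩
  + r ℤ.- (+ r ℤ.+ q ℤ.* + n)  ≡⟨ cancel (+ r) q (+ n) ⟩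
  ℤ.- q ℤ.* + n                ∎))
  where
  open ≡.≡-Reasoning
  r : ℕ
  r = x %ℕ n
  q : ℤ
  q = x /ℕ n
  cancel : ∀ r q d → r ℤ.- (r ℤ.+ q ℤ.* d) ≡ ℤ.- q ℤ.* d
  cancel = solve-∀

⊕C-enumeration : ∀ {t} (m : Fin t → ℕ) → (∀ i → 1 ≤ m i) →
                 Enumeration (AbelianGroup.setoid (⊕C-abelianGroup m)) (prodℕ m)
⊕C-enumeration {ℕ.zero}  m pos = record { enum = λ _ (); index = λ _ → fz; enum-index = λ _ () }
⊕C-enumeration {ℕ.suc t} m pos = record { enum = enum; index = index; enum-index = enum-index }
  where
  module E = Enumeration (⊕C-enumeration (m ∘ fs) (pos ∘ fs))
  instance
    m₀≢0 : NonZero (m fz)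
    m₀≢0 = ℕ.>-nonZero (pos fz)

  cons : Fin (m fz) × Fin (prodℕ (m ∘ fs)) → Fin (ℕ.suc t) → ℤ
  cons (r , c) = + toℕ r Vector.∷ E.enum c

  enum : Fin (prodℕ m) → Fin (ℕ.suc t) → ℤ
  enum = cons ∘ remQuot {m fz} (prodℕ (m ∘ fs))

  index : (Fin (ℕ.suc t) → ℤ) → Fin (prodℕ m)
  index x = combine (residue (m fz) (x fz)) (E.index (x ∘ fs))

  enum-index : ∀ x i → enum (index x) i ≡ x i [mod m i ]
  enum-index x = ≡.subst (λ p → ∀ i → cons p i ≡ x i [mod m i ]) (≡.sym (remQuot-combine r c)) cons≡x
    where
    r = residue (m fz) (x fz)
    c = E.index (x ∘ fs)
    cons≡x : ∀ i → cons (r , c) i ≡ x i [mod m i ]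
    cons≡x fz     = residue-≡[mod] (m fz) (x fz)
    cons≡x (fs i) = E.enum-index (x ∘ fs) i

-- Signed sums of distinct powers of two

ℤ+ : AbelianGroup 0ℓ 0ℓ
ℤ+ = ℤ.+-0-abelianGroup

module ℤΣ = SignedSubsums ℤ+

signedSumℤ : ∀ {k} → Subset k → (Fin k → Sign) → (Fin k → ℤ) → ℤ
signedSumℤ = signedSubsum ℤ+

double-isGroupHomomorphism :
  GroupMorphisms.IsGroupHomomorphism (AbelianGroup.rawGroup ℤ+) (AbelianGroup.rawGroup ℤ+) (+ 2 ℤ.*_)
double-isGroupHomomorphism = record
  { isMonoidHomomorphism = record
    { isMagmaHomomorphism = record
      { isRelHomomorphism = record { cong = ≡.cong (+ 2 ℤ.*_) }
      ; homo              = ℤ.*-distribˡ-+ (+ 2)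
      }
    ; ε-homo = ℤ.*-zeroʳ (+ 2)
    }
  ; ⁻¹-homo = λ x → ≡.sym (ℤ.neg-distribʳ-* (+ 2) x)
  }

pow2 : ∀ {k} → Fin k → ℤ
pow2 fz     = + 1
pow2 (fs j) = + 2 ℤ.* pow2 j

signedSumℤ-pow2∘suc : ∀ {k} (I : Subset k) a →
                      signedSumℤ I a (pow2 ∘ fs) ≡ + 2 ℤ.* signedSumℤ I a pow2
signedSumℤ-pow2∘suc I a = ≡.sym (signedSubsum-homo ℤ+ ℤ+ double-isGroupHomomorphism I a pow2)

∣signed1∣ : ∀ s → ∣ signed ℤ+ s (+ 1) ∣ ≡ 1
∣signed1∣ plus  = ≡.refl
∣signed1∣ minus = ≡.refl

odd≢0 : ∀ s w → signed ℤ+ s (+ 1) ℤ.+ + 2 ℤ.* w ≢ + 0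
odd≢0 s w eq = ℕ.<⇒≱ (ℕ.n<1+n 1) (ℕ∣.∣⇒≤ 2∣1)
  where
  2∣±1 : + 2 Signed.∣ signed ℤ+ s (+ 1)
  2∣±1 = Signed.∣m+n∣n⇒∣m (≡.subst (+ 2 Signed.∣_) (≡.sym eq) (Signed.divides (+ 0) ≡.refl))
                          (Signed.∣m⇒∣m*n w Signed.∣-refl)
  2∣1 : 2 ℕ∣.∣ 1
  2∣1 = ≡.subst (2 ℕ∣.∣_) (∣signed1∣ s) (Signed.∣⇒∣ᵤ 2∣±1)

signedSumℤ-pow2≡0⇒Empty : ∀ {k} (I : Subset k) a → signedSumℤ I a pow2 ≡ + 0 → Empty I
signedSumℤ-pow2≡0⇒Empty []          a eq ()
signedSumℤ-pow2≡0⇒Empty (true ∷ I)  a eq _ =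
  odd≢0 (a fz) (signedSumℤ I (a ∘ fs) pow2)
    (≡.trans (≡.cong (λ v → signed ℤ+ (a fz) (+ 1) ℤ.+ v) (≡.sym (signedSumℤ-pow2∘suc I (a ∘ fs))))
             eq)
signedSumℤ-pow2≡0⇒Empty (false ∷ I) a eq (fs x , there x∈I) =
  signedSumℤ-pow2≡0⇒Empty I (a ∘ fs) w≡0 (x , x∈I)
  where
  w≡0 : signedSumℤ I (a ∘ fs) pow2 ≡ + 0
  w≡0 = ℤ.*-cancelˡ-≡ (+ 2) _ _ (≡.trans (≡.sym (signedSumℤ-pow2∘suc I (a ∘ fs))) eq)

signedSumℤ-pow2< : ∀ {k} (I : Subset k) a → ∣ signedSumℤ I a pow2 ∣ < 2 ^ k
signedSumℤ-pow2< []                        a = s≤s z≤n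
signedSumℤ-pow2< {ℕ.suc k} (true ∷ I)  a = begin-strict
  ∣ signed ℤ+ (a fz) (+ 1) ℤ.+ signedSumℤ I (a ∘ fs) (pow2 ∘ fs) ∣
    ≤⟨ ℤ.∣i+j∣≤∣i∣+∣j∣ (signed ℤ+ (a fz) (+ 1)) _ ⟩
  (∣ signed ℤ+ (a fz) (+ 1) ∣) + (∣ signedSumℤ I (a ∘ fs) (pow2 ∘ fs) ∣)
    ≡⟨ ≡.cong₂ _+_ (∣signed1∣ (a fz))
                   (≡.trans (≡.cong ∣_∣ (signedSumℤ-pow2∘suc I (a ∘ fs))) (ℤ.abs-* (+ 2) w)) ⟩
  1 + 2 ℕ.* ∣ w ∣         <⟨ ℕ.n<1+n _ ⟩
  2 + 2 ℕ.* ∣ w ∣         ≡⟨ ℕ.*-suc 2 ∣ w ∣ ⟨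
  2 ℕ.* ℕ.suc ∣ w ∣       ≤⟨ ℕ.*-monoʳ-≤ 2 (signedSumℤ-pow2< I (a ∘ fs)) ⟩
  2 ℕ.* 2 ^ k             ∎
  where
  open ℕ.≤-Reasoning
  w : ℤ
  w = signedSumℤ I (a ∘ fs) pow2
signedSumℤ-pow2< {ℕ.suc k} (false ∷ I) a = begin-strict
  ∣ signedSumℤ I (a ∘ fs) (pow2 ∘ fs) ∣  ≡⟨ ≡.cong ∣_∣ (signedSumℤ-pow2∘suc I (a ∘ fs)) ⟩
  ∣ + 2 ℤ.* w ∣                          ≡⟨ ℤ.abs-* (+ 2) w ⟩
  2 ℕ.* ∣ w ∣                            <⟨ ℕ.*-monoʳ-< 2 (signedSumℤ-pow2< I (a ∘ fs)) ⟩
  2 ℕ.* 2 ^ k                            ∎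
  where
  open ℕ.≤-Reasoning
  w : ℤ
  w = signedSumℤ I (a ∘ fs) pow2

smallMultiple≡0 : ∀ {n x} → + n ∣ x → ∣ x ∣ < n → x ≡ + 0
smallMultiple≡0 {x = x} n∣x ∣x∣<n with ∣ x ∣ in eq
... | ℕ.zero  = ℤ.∣i∣≡0⇒i≡0 eq
... | ℕ.suc _ = ⊥-elim (ℕ.<⇒≱ ∣x∣<n (ℕ∣.∣⇒≤ n∣x))

signedSumℤ-pow2≡0[mod]⇒Empty : ∀ {k n} (I : Subset k) a → 2 ^ k ≤ n →
                                signedSumℤ I a pow2 ≡ + 0 [mod n ] → Empty I
signedSumℤ-pow2≡0[mod]⇒Empty {n = n} I a 2^k≤n S≡0 =
  signedSumℤ-pow2≡0⇒Empty I a
    (smallMultiple≡0 (≡.subst (+ n ∣_) (ℤ.+-identityʳ S) S≡0)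
                     (ℕ.<-≤-trans (signedSumℤ-pow2< I a) 2^k≤n))
  where
  S : ℤ
  S = signedSumℤ I a pow2

⌊n/2⌋+⌊n/2⌋≤n : ∀ n → ℕ.⌊ n /2⌋ + ℕ.⌊ n /2⌋ ≤ n
⌊n/2⌋+⌊n/2⌋≤n ℕ.zero              = z≤n
⌊n/2⌋+⌊n/2⌋≤n (ℕ.suc ℕ.zero)       = z≤n
⌊n/2⌋+⌊n/2⌋≤n (ℕ.suc (ℕ.suc n)) =
  s≤s (≡.subst (_≤ ℕ.suc n) (≡.sym (ℕ.+-suc h h)) (s≤s (⌊n/2⌋+⌊n/2⌋≤n n)))
  where
  h : ℕ
  h = ℕ.⌊ n /2⌋

-- Stated for `⌊log2⌋` with an arbitrary accessibility proof so that the recursion unfolds.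
2^⌊log2⌋n≤n : ∀ n (rec : Acc _<_ n) → .{{NonZero n}} → 2 ^ ⌊log2⌋ n rec ≤ n
2^⌊log2⌋n≤n (ℕ.suc ℕ.zero)    _         = s≤s z≤n
2^⌊log2⌋n≤n (ℕ.suc (ℕ.suc n)) (acc rec) = begin
  2 ℕ.* 2 ^ ⌊log2⌋ (ℕ.suc h) _  ≤⟨ ℕ.*-monoʳ-≤ 2 (2^⌊log2⌋n≤n (ℕ.suc h) _) ⟩
  2 ℕ.* ℕ.suc h                 ≡⟨ ℕ.*-suc 2 h ⟩
  2 + (h + (h + 0))             ≡⟨ ≡.cong (λ v → 2 + (h + v)) (ℕ.+-identityʳ h) ⟩
  2 + (h + h)                   ≤⟨ ℕ.+-monoʳ-≤ 2 (⌊n/2⌋+⌊n/2⌋≤n n) ⟩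
  ℕ.suc (ℕ.suc n)               ∎
  where
  open ℕ.≤-Reasoning
  h : ℕ
  h = ℕ.⌊ n /2⌋

2^⌊log₂n⌋≤n : ∀ n → .{{NonZero n}} → 2 ^ ⌊log₂ n ⌋ ≤ n
2^⌊log₂n⌋≤n n = 2^⌊log2⌋n≤n n _

n<2^[⌊log₂n⌋+1] : ∀ n → n < 2 ^ (⌊log₂ n ⌋ + 1)
n<2^[⌊log₂n⌋+1] n = ℕ.≰⇒> λ 2^[e+1]≤n → ℕ.<⇒≱ (ℕ.m<m+n e (s≤s z≤n))
  (≡.subst (_≤ e) (⌊log₂[2^n]⌋≡n (e + 1)) (⌊log₂⌋-mono-≤ 2^[e+1]≤n))
  where
  e : ℕ
  e = ⌊log₂ n ⌋

-- A sequence of length Σ ⌊log₂ m_i⌋ without ±-zero-subsum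

module _ {t} (m : Fin t → ℕ) where

  signedSubsum-component : ∀ {k} (I : Subset k) a (h : Fin k → Fin t → ℤ) i →
                           signedSubsum (⊕C-abelianGroup m) I a h i ≡ signedSumℤ I a (λ j → h j i)
  signedSubsum-component []          a h i = ≡.refl
  signedSubsum-component (true ∷ I)  a h i =
    ≡.cong₂ ℤ._+_ (signed-component (a fz)) (signedSubsum-component I (a ∘ fs) (h ∘ fs) i)
    where
    signed-component : ∀ s → signed (⊕C-abelianGroup m) s (h fz) i ≡ signed ℤ+ s (h fz i)
    signed-component plus  = ≡.refl
    signed-component minus = ≡.refl
  signedSubsum-component (false ∷ I) a h i = signedSubsum-component I (a ∘ fs) (h ∘ fs) i

lowerBoundSequence : ∀ {t} (m : Fin t → ℕ) → Fin (sumℕ (λ i → ⌊log₂ m i ⌋)) → Fin t → ℤ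
lowerBoundSequence {ℕ.zero}  m ()
lowerBoundSequence {ℕ.suc t} m =
  (λ j → pow2 j Vector.∷ λ _ → + 0) Vector.++ (λ j → + 0 Vector.∷ lowerBoundSequence (m ∘ fs) j)

lowerBoundSequence-zeroSubsum⇒Empty : ∀ {t} (m : Fin t → ℕ) → (∀ i → 1 ≤ m i) → ∀ I a →
  (∀ i → signedSubsum (⊕C-abelianGroup m) I a (lowerBoundSequence m) i ≡ + 0 [mod m i ]) → Empty I
lowerBoundSequence-zeroSubsum⇒Empty {ℕ.zero}  m pos I a S≡0 ()
lowerBoundSequence-zeroSubsum⇒Empty {ℕ.suc t} m pos I a S≡0
  with I₁ , I₂ , ≡.refl ← splitAt ⌊log₂ m fz ⌋ I = Empty-++ firstBlock otherBlocks
  where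
  e s : ℕ
  e = ⌊log₂ m fz ⌋
  s = sumℕ (λ i → ⌊log₂ m (fs i) ⌋)
  h' : Fin s → Fin t → ℤ
  h' = lowerBoundSequence (m ∘ fs)
  powers : Fin e → Fin (ℕ.suc t) → ℤ
  powers j = pow2 j Vector.∷ λ _ → + 0
  shifted : Fin s → Fin (ℕ.suc t) → ℤ
  shifted j = + 0 Vector.∷ h' j
  a₁ : Fin e → Sign
  a₁ = a ∘ (_↑ˡ s)
  a₂ : Fin s → Sign
  a₂ = a ∘ (e ↑ʳ_)

  S : Fin (ℕ.suc t) → ℤ
  S = signedSubsum (⊕C-abelianGroup m) (I₁ ++ I₂) a (powers Vector.++ shifted)

  S-split : ∀ i → S i ≡ signedSumℤ I₁ a₁ (λ j → powers j i) ℤ.+ signedSumℤ I₂ a₂ (λ j → shifted j i)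
  S-split i = begin
    S i
      ≡⟨ signedSubsum-component m (I₁ ++ I₂) a (powers Vector.++ shifted) i ⟩
    signedSumℤ (I₁ ++ I₂) a (λ j → (powers Vector.++ shifted) j i)
      ≡⟨ ℤΣ.signedSubsum-++ I₁ I₂ a (λ j → (powers Vector.++ shifted) j i) ⟩
    signedSumℤ I₁ a₁ (λ j → (powers Vector.++ shifted) (j ↑ˡ s) i) ℤ.+
    signedSumℤ I₂ a₂ (λ j → (powers Vector.++ shifted) (e ↑ʳ j) i)
      ≡⟨ ≡.cong₂ ℤ._+_
           (ℤΣ.signedSubsum-cong I₁ (λ _ → ≡.refl) (λ j → ≡.cong-app (lookup-++ˡ powers shifted j) i))
           (ℤΣ.signedSubsum-cong I₂ (λ _ → ≡.refl) (λ j → ≡.cong-app (lookup-++ʳ powers shifted j) i)) ⟩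
    signedSumℤ I₁ a₁ (λ j → powers j i) ℤ.+ signedSumℤ I₂ a₂ (λ j → shifted j i)
      ∎
    where open ≡.≡-Reasoning

  S₀≡ : S fz ≡ signedSumℤ I₁ a₁ pow2
  S₀≡ = begin
    S fz                                         ≡⟨ S-split fz ⟩
    signedSumℤ I₁ a₁ pow2 ℤ.+ signedSumℤ I₂ a₂ (λ _ → + 0)
                                                 ≡⟨ ≡.cong (λ v → signedSumℤ I₁ a₁ pow2 ℤ.+ v)
                                                           (ℤΣ.signedSubsum-ε I₂ a₂ (λ _ → ≡.refl)) ⟩
    signedSumℤ I₁ a₁ pow2 ℤ.+ + 0                ≡⟨ ℤ.+-identityʳ _ ⟩
    signedSumℤ I₁ a₁ pow2                        ∎
    where open ≡.≡-Reasoning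

  S₁₊ᵢ≡ : ∀ i → S (fs i) ≡ signedSubsum (⊕C-abelianGroup (m ∘ fs)) I₂ a₂ h' i
  S₁₊ᵢ≡ i = begin
    S (fs i)                                     ≡⟨ S-split (fs i) ⟩
    signedSumℤ I₁ a₁ (λ _ → + 0) ℤ.+ signedSumℤ I₂ a₂ (λ j → h' j i)
                                                 ≡⟨ ≡.cong (λ v → v ℤ.+ signedSumℤ I₂ a₂ (λ j → h' j i))
                                                           (ℤΣ.signedSubsum-ε I₁ a₁ (λ _ → ≡.refl)) ⟩
    + 0 ℤ.+ signedSumℤ I₂ a₂ (λ j → h' j i)      ≡⟨ ℤ.+-identityˡ _ ⟩
    signedSumℤ I₂ a₂ (λ j → h' j i)              ≡⟨ signedSubsum-component (m ∘ fs) I₂ a₂ h' i ⟨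
    signedSubsum (⊕C-abelianGroup (m ∘ fs)) I₂ a₂ h' i ∎
    where open ≡.≡-Reasoning

  firstBlock : Empty I₁
  firstBlock = signedSumℤ-pow2≡0[mod]⇒Empty I₁ a₁ (2^⌊log₂n⌋≤n (m fz) {{ℕ.>-nonZero (pos fz)}})
                 (≡.subst (λ v → v ≡ + 0 [mod m fz ]) S₀≡ (S≡0 fz))

  otherBlocks : Empty I₂
  otherBlocks = lowerBoundSequence-zeroSubsum⇒Empty (m ∘ fs) (pos ∘ fs) I₂ a₂
                  λ i → ≡.subst (λ v → v ≡ + 0 [mod m (fs i) ]) (S₁₊ᵢ≡ i) (S≡0 (fs i))

⊕C-¬PMZeroSumProperty : ∀ {t} (m : Fin t → ℕ) → (∀ i → 1 ≤ m i) →
                        ¬ PMZeroSumProperty (⊕C-abelianGroup m) (sumℕ (λ i → ⌊log₂ m i ⌋))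
⊕C-¬PMZeroSumProperty m pos P
  with I , I≢∅ , a , S≡0 ← P _ ℕ.≤-refl (lowerBoundSequence m) =
  lowerBoundSequence-zeroSubsum⇒Empty m pos I a S≡0 I≢∅

theorem3p1 : ∀ {c ℓ} (G : AbelianGroup c ℓ) (t : ℕ) (m : Fin t → ℕ) →
    (∀ i → 1 ≤ m i) → IsoToDirectSum G m →
    Σ ℕ λ D → IsDpm G D ×
      (sumℕ (λ i → ⌊log₂ m i ⌋) + 1 ≤ D) × (D ≤ ⌊log₂ prodℕ m ⌋ + 1)
theorem3p1 G t m pos (φ , φ-iso) =
  IsDpm-between G enumeration (≈-dec-iso G ⊕C φ-iso (⊕C-≈-dec m)) lower upper
  where
  ⊕C : AbelianGroup 0ℓ 0ℓ
  ⊕C = ⊕C-abelianGroup m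
  open GroupMorphisms.IsGroupIsomorphism φ-iso using (isGroupHomomorphism; surjective)

  enumeration : Enumeration (AbelianGroup.setoid G) (prodℕ m)
  enumeration = Enumeration-iso G ⊕C φ-iso (⊕C-enumeration m pos)

  upper : PMZeroSumProperty G (⌊log₂ prodℕ m ⌋ + 1)
  upper = PMZeroSumProperty-pigeonhole G enumeration (n<2^[⌊log₂n⌋+1] (prodℕ m))

  lower : ¬ PMZeroSumProperty G (sumℕ (λ i → ⌊log₂ m i ⌋))
  lower = ⊕C-¬PMZeroSumProperty m pos ∘ PMZeroSumProperty-image G ⊕C isGroupHomomorphism surjective
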